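{- Let $X$ be a traceable graph and let $G$ be any graph obtained as follows: take the disjoint union of $X$ and a path $P_n$ with $n \ge 3$ and end-vertices $y$ and $y'$; join $y$ to every vertex of $X$; and join $y'$ to every vertex of a set $W \subseteq V(X)$, where $W$ contains at least one end-vertex of some Hamiltonian path of $X$. Then $\gamma_g(G) \le \left\lceil \frac{n(G)}{2}\right\rceil$.
   Context: A graph is traceable if it contains a Hamiltonian path. The domination game on a graph $G$ is played by Dominator and Staller, who alternately select vertices of $G$; each selected vertex must dominate (i.e., be equal or adjacent to) at least one vertex not dominated by the previously selected vertices. The game ends when no such move is possible. Dominator wants to minimize the number of moves, Staller to maximize it. $\gamma_g(G)$ is the number of moves when both play optimally and Dominator makes the first move. $n(G)$ denotes the number of vertices of $G$. -}

module Defs where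

open import Data.Nat using (ℕ; zero; suc; _+_; _∸_; _⊓_; _⊔_)
open import Data.Bool using (Bool; true; false; _∧_; _∨_; not; if_then_else_)
open import Data.Fin using (Fin; toℕ; splitAt)
open import Data.Fin.Properties using (_≟_)
open import Data.Sum using (_⊎_; inj₁; inj₂)
open import Data.Maybe using (Maybe; just)
open import Data.Bool.ListAction using (any; all)
open import Data.List using (List; []; _∷_; allFin; map; foldr; filterᵇ; head; last)
open import Data.List.Membership.Propositional using (_∈_)
open import Data.List.Relation.Unary.Unique.Propositional using (Unique)
open import Relation.Nullary.Decidable using (⌊_⌋)
open import Relation.Binary.PropositionalEquality using (_≡_)
open import Data.Product using (Σ; _×_)

Adj : ℕ → Set
Adj N = Fin N → Fin N → Bool

IsSimpleGraph : ∀ {N} → Adj N → Set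
IsSimpleGraph {N} adj =
  ((u v : Fin N) → adj u v ≡ adj v u) × ((v : Fin N) → adj v v ≡ false)

data IsWalk {N : ℕ} (adj : Adj N) : List (Fin N) → Set where
  walk-[]  : IsWalk adj []
  walk-[x] : ∀ x → IsWalk adj (x ∷ [])
  walk-∷   : ∀ x y rest → adj x y ≡ true → IsWalk adj (y ∷ rest) →
             IsWalk adj (x ∷ y ∷ rest)

IsHamiltonianPath : ∀ {N} → Adj N → List (Fin N) → Set
IsHamiltonianPath {N} adj ps =
  IsWalk adj ps × Unique ps × ((v : Fin N) → v ∈ ps)

Traceable : ∀ {N} → Adj N → Set
Traceable {N} adj = Σ (List (Fin N)) (IsHamiltonianPath adj)

IsEndVertex : ∀ {N} → List (Fin N) → Fin N → Set
IsEndVertex ps w = (head ps ≡ just w) ⊎ (last ps ≡ just w)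

_==_ : ∀ {N} → Fin N → Fin N → Bool
u == v = ⌊ u ≟ v ⌋

closedNbhd : ∀ {N} → Adj N → Fin N → Fin N → Bool
closedNbhd adj v u = (u == v) ∨ adj v u

-- a dominated set, as a Boolean predicate on vertices
DomSet : ℕ → Set
DomSet N = Fin N → Bool

legal : ∀ {N} → Adj N → DomSet N → Fin N → Bool
legal {N} adj D v = any (λ u → closedNbhd adj v u ∧ not (D u)) (allFin N)

allDominated : ∀ {N} → DomSet N → Bool
allDominated {N} D = all D (allFin N)

play : ∀ {N} → Adj N → DomSet N → Fin N → DomSet N
play adj D v u = D u ∨ closedNbhd adj v u

data Player : Set where
  dominator staller : Player

other : Player → Player
other dominator = staller
other staller   = dominator

minList maxList : List ℕ → ℕ
minList []       = 0
minList (x ∷ xs) = foldr _⊓_ x xs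
maxList = foldr _⊔_ 0

-- The fuel bounds the remaining game length; since every move dominates
-- a new vertex, fuel N (the number of vertices) is always sufficient.
gameValue : ∀ {N} → Adj N → ℕ → Player → DomSet N → ℕ
gameValue adj zero    p D = 0
gameValue {N} adj (suc f) p D =
  if allDominated D then 0
  else suc (opt p (map (λ v → gameValue adj f (other p) (play adj D v))
                       (filterᵇ (legal adj D) (allFin N))))
  where
  opt : Player → List ℕ → ℕ
  opt dominator = minList
  opt staller   = maxList

γg : ∀ {N} → Adj N → ℕ
γg {N} adj = gameValue adj N dominator (λ _ → false)

-- The construction of Proposition 5.2.
-- X on Fin k, path P_n on Fin n with vertices 0,1,…,n-1 in order,
-- y = 0 and y' = n-1.  G has vertex set Fin (k + n): the first k
-- vertices are those of X, the last n those of P_n.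

pathAdj : ∀ {n} → Fin n → Fin n → Bool
pathAdj i j = ⌊ suc (toℕ i) Data.Nat.≟ toℕ j ⌋ ∨ ⌊ suc (toℕ j) Data.Nat.≟ toℕ i ⌋

isY : ∀ {n} → Fin n → Bool
isY j = ⌊ toℕ j Data.Nat.≟ 0 ⌋

isY' : ∀ {n} → Fin n → Bool
isY' {n} j = ⌊ toℕ j Data.Nat.≟ n ∸ 1 ⌋

crossAdj : ∀ {k n} → (Fin k → Bool) → Fin k → Fin n → Bool
crossAdj W x j = isY j ∨ (isY' j ∧ W x)

adjSum : ∀ {k n} → Adj k → (Fin k → Bool) →
         Fin k ⊎ Fin n → Fin k ⊎ Fin n → Bool
adjSum adjX W (inj₁ x) (inj₁ x') = adjX x x'
adjSum adjX W (inj₂ i) (inj₂ j)  = pathAdj i j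
adjSum adjX W (inj₁ x) (inj₂ j)  = crossAdj W x j
adjSum adjX W (inj₂ i) (inj₁ x)  = crossAdj W x i

constructG : ∀ {k} (n : ℕ) → Adj k → (Fin k → Bool) → Adj (k + n)
constructG {k} n adjX W u v = adjSum adjX W (splitAt k u) (splitAt k v)

module Submission where

-- Dominator opens on y, which dominates y, its path neighbour and all
-- of X; afterwards only path vertices can be undominated.  Read the path as a
-- Boolean pattern (with dominated sentinels on both sides) and let the
-- potential Φ count its undominated vertices plus its maximal runs of
-- undominated vertices.  Every legal move fills a window of three consecutive
-- path positions (a path vertex dominates itself and its neighbours, a vertex
-- of W dominates only y' anew, other vertices of X dominate nothing new), so
-- it lowers Φ by at least 1; Dominator can lower Φ by 3, or by 2 when every
-- run is a single vertex, in which case Φ is even.  A potential argument valid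
-- for every graph then bounds the rest of the game by ⌊Φ/2⌋ (Dominator to
-- move) and ⌊(Φ+1)/2⌋ (Staller to move).  After the opening Φ = n − 1, hence
-- γ_g(G) ≤ 1 + ⌊n/2⌋ ≤ ⌈(n(X) + n)/2⌉ because X is nonempty.

open import Defs
open import Data.Nat using (ℕ; zero; suc; _+_; _*_; _∸_; _≤_; _<_; _≥_; z≤n; s≤s; ⌊_/2⌋; ⌈_/2⌉; _≤?_; _<?_)
open import Data.Nat.Properties
  using ( ≤-refl; ≤-trans; ≤-antisym; ≤-reflexive; ≤-pred; <-trans; <-cmp; ≰⇒>; ≮⇒≥; <⇒≤; <⇒≢; >⇒≢; <⇒≱
        ; n≤1+n; n<1+n; m≤m+n; m≤n+m; m≤n⇒m≤1+n; m<n⇒m<1+n; m≤n⇒m<n∨m≡n; m+n≤o⇒n≤o; m+[n∸m]≡n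
        ; +-suc; +-comm; +-assoc; +-identityʳ; +-mono-≤; +-monoˡ-≤; +-monoʳ-≤; m⊓n≤m; m⊓n≤n; ⊔-lub
        ; ⌊n/2⌋-mono; n≡⌊n+n/2⌋; module ≤-Reasoning )
open import Data.Nat.Tactic.RingSolver using (solve-∀)
import Data.Nat as ℕ
open import Data.Bool using (Bool; true; false; _∧_; _∨_; not)
open import Data.Bool.Properties using (T?; T-≡; ∨-zeroʳ; ∨-identityʳ; ∧-zeroʳ)
open import Data.Bool.ListAction using (any; all)
open import Data.Fin using (Fin; toℕ; _↑ˡ_; _↑ʳ_; splitAt; fromℕ<) renaming (zero to fzero; suc to fsuc)
open import Data.Fin.Properties
  using ( _≟_; splitAt-↑ˡ; splitAt-↑ʳ; splitAt⁻¹-↑ˡ; splitAt⁻¹-↑ʳ; toℕ-injective; ↑ʳ-injective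
        ; toℕ<n; toℕ-↑ˡ; toℕ-↑ʳ; toℕ-fromℕ< )
open import Data.List using (List; _∷_; map; foldr; filterᵇ; allFin)
open import Data.List.Properties using (foldr-preservesᵇ; foldr-preservesᵒ)
open import Data.List.Relation.Unary.All as All using (All)
open import Data.List.Relation.Unary.All.Properties using (all⁺; all⁻; ¬All⇒Any¬)
open import Data.List.Relation.Unary.Any as Any using (Any; here; there; satisfied)
open import Data.List.Relation.Unary.Any.Properties using (any⁺; any⁻)
open import Data.List.Membership.Propositional using (_∈_; lose)
open import Data.List.Membership.Propositional.Properties using (∈-allFin; ∈-map⁺; ∈-map⁻; ∈-filter⁺; ∈-filter⁻)
open import Data.Product using (Σ; _×_; _,_; proj₁; proj₂)
open import Data.Sum using (_⊎_; inj₁; inj₂; [_,_]; swap) renaming (map to map-⊎)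
open import Data.Unit using (⊤; tt)
open import Data.Empty using (⊥-elim)
open import Function using (_∘_)
open import Function.Bundles using (Equivalence)
open import Relation.Nullary using (Dec; ¬_; yes; no)
open import Relation.Nullary.Decidable using (⌊_⌋; isYes≗does; dec-true; dec-false)
open import Relation.Binary using (tri<; tri≈; tri>)
open import Relation.Binary.PropositionalEquality
  using (_≡_; _≢_; refl; sym; trans; cong; cong₂; subst; module ≡-Reasoning)


true-or-false : ∀ b → b ≡ true ⊎ b ≡ false
true-or-false true  = inj₁ refl
true-or-false false = inj₂ refl

clash : ∀ {A : Set} {x : Bool} → x ≡ true → x ≡ false → A
clash refl ()

⌊⌋-true : ∀ {P : Set} (d : Dec P) → P → ⌊ d ⌋ ≡ true
⌊⌋-true d p = trans (isYes≗does d) (dec-true d p)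

⌊⌋-false : ∀ {P : Set} (d : Dec P) → ¬ P → ⌊ d ⌋ ≡ false
⌊⌋-false d ¬p = trans (isYes≗does d) (dec-false d ¬p)

∨-trueˡ : ∀ {x} y → x ≡ true → x ∨ y ≡ true
∨-trueˡ y refl = refl

∨-trueʳ : ∀ x {y} → y ≡ true → x ∨ y ≡ true
∨-trueʳ x refl = ∨-zeroʳ x

∧-not : ∀ {a b} → a ∧ not b ≡ true → a ≡ true × b ≡ false
∧-not {true} {false} _ = refl , refl

satisfying-entry : ∀ {A : Set} (p : A → Bool) xs → any p xs ≡ true → Σ A λ x → p x ≡ true
satisfying-entry p xs holds with satisfied (any⁻ p xs (Equivalence.from T-≡ holds))
... | x , px = x , Equivalence.to T-≡ px

any-holds : ∀ {A : Set} (p : A → Bool) {x xs} → x ∈ xs → p x ≡ true → any p xs ≡ true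
any-holds p x∈ px = Equivalence.to T-≡ (any⁺ p (lose x∈ (Equivalence.from T-≡ px)))

failing-entry : ∀ {A : Set} (p : A → Bool) xs → all p xs ≡ false → Σ A λ x → p x ≡ false
failing-entry p xs fails
  with satisfied (¬All⇒Any¬ (λ x → T? (p x)) xs λ holds → clash (Equivalence.to T-≡ (all⁻ p holds)) fails)
... | x , ¬px with true-or-false (p x)
...   | inj₁ px = ⊥-elim (¬px (Equivalence.from T-≡ px))
...   | inj₂ px = x , px

all-fails : ∀ {A : Set} (p : A → Bool) {x xs} → x ∈ xs → p x ≡ false → all p xs ≡ false
all-fails p {xs = xs} x∈ px with true-or-false (all p xs)
... | inj₁ holds = clash (Equivalence.to T-≡ (All.lookup (all⁺ p xs (Equivalence.from T-≡ holds)) x∈)) px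
... | inj₂ fails = fails

⊓-fold-≤ : ∀ {c} a xs → a ≤ c ⊎ Any (_≤ c) xs → foldr ℕ._⊓_ a xs ≤ c
⊓-fold-≤ = foldr-preservesᵒ λ a b → [ ≤-trans (m⊓n≤m a b) , ≤-trans (m⊓n≤n a b) ]

minList-≤ : ∀ {x xs} → x ∈ xs → minList xs ≤ x
minList-≤ {xs = y ∷ ys} (here refl) = ⊓-fold-≤ y ys (inj₁ ≤-refl)
minList-≤ {xs = y ∷ ys} (there x∈) = ⊓-fold-≤ y ys (inj₂ (Any.map (λ x≡z → ≤-reflexive (sym x≡z)) x∈))

maxList-≤ : ∀ {B xs} → All (_≤ B) xs → maxList xs ≤ B
maxList-≤ = foldr-preservesᵇ ⊔-lub z≤n


finished-value : ∀ {N} (G : Adj N) f p D → allDominated D ≡ true → gameValue G f p D ≡ 0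
finished-value G zero    p D _    = refl
finished-value G (suc f) p D done rewrite done = refl

dominator-value≤ : ∀ {N} (G : Adj N) f D v → allDominated D ≡ false → legal G D v ≡ true →
  gameValue G (suc f) dominator D ≤ suc (gameValue G f staller (play G D v))
dominator-value≤ G f D v unfinished lv rewrite unfinished =
  s≤s (minList-≤ (∈-map⁺ _ (∈-filter⁺ (λ u → T? (legal G D u)) (∈-allFin v) (Equivalence.from T-≡ lv))))

staller-value≤ : ∀ {N} (G : Adj N) f D B v₀ → allDominated D ≡ false → legal G D v₀ ≡ true →
  (∀ v → legal G D v ≡ true → gameValue G f dominator (play G D v) < B) →
  gameValue G (suc f) staller D ≤ B
staller-value≤ G f D zero v₀ _ lv₀ below with () ← below v₀ lv₀
staller-value≤ {N} G f D (suc B) v₀ unfinished _ below rewrite unfinished =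
  s≤s (maxList-≤ (All.tabulate bounded))
  where
  bounded : ∀ {x} → x ∈ map (λ v → gameValue G f dominator (play G D v)) (filterᵇ (legal G D) (allFin N)) → x ≤ B
  bounded x∈ with ∈-map⁻ _ x∈
  ... | v , v∈ , refl =
    ≤-pred (below v (Equivalence.to T-≡ (proj₂ (∈-filter⁻ (λ u → T? (legal G D u)) {xs = allFin N} v∈))))


IsEven : ℕ → Set
IsEven x = Σ ℕ λ h → x ≡ h + h

GoodDrop : ℕ → ℕ → Set
GoodDrop x y = 3 + x ≤ y ⊎ (2 + x ≤ y × IsEven y)

⌊suc[h+h]/2⌋≡h : ∀ h → ⌊ suc (h + h) /2⌋ ≡ h
⌊suc[h+h]/2⌋≡h zero    = refl
⌊suc[h+h]/2⌋≡h (suc h) = cong suc (trans (cong ⌊_/2⌋ (+-suc h h)) (⌊suc[h+h]/2⌋≡h h))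

-- A good drop pays for Dominator's move: the Staller bound afterwards is one
-- less than the Dominator bound before.
good-drop-halves : ∀ {x y} → GoodDrop x y → suc ⌊ suc x /2⌋ ≤ ⌊ y /2⌋
good-drop-halves (inj₁ drop3) = ⌊n/2⌋-mono drop3
good-drop-halves (inj₂ (drop2 , h , refl)) =
  ≤-trans (⌊n/2⌋-mono (s≤s drop2)) (≤-reflexive (trans (⌊suc[h+h]/2⌋≡h h) (n≡⌊n+n/2⌋ h)))

module PotentialArgument {N} (G : Adj N) (Inv : DomSet N → Set) (Φ : DomSet N → ℕ)
  (inv-play : ∀ D v → Inv D → Inv (play G D v))
  (move-lowers : ∀ D v → Inv D → legal G D v ≡ true → suc (Φ (play G D v)) ≤ Φ D)
  (good-move : ∀ D → Inv D → allDominated D ≡ false →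
               Σ (Fin N) λ v → legal G D v ≡ true × GoodDrop (Φ (play G D v)) (Φ D))
  where

  value-bounds : ∀ f D → Inv D →
    gameValue G f staller D ≤ ⌊ suc (Φ D) /2⌋ × gameValue G f dominator D ≤ ⌊ Φ D /2⌋
  value-bounds zero    D inv = z≤n , z≤n
  value-bounds (suc f) D inv with true-or-false (allDominated D)
  ... | inj₁ finished = ≤-trans (≤-reflexive (finished-value G (suc f) staller D finished)) z≤n
                      , ≤-trans (≤-reflexive (finished-value G (suc f) dominator D finished)) z≤n
  ... | inj₂ unfinished with good-move D inv unfinished
  ...   | v* , legal* , drop* = staller-bound , dominator-bound
    where
    staller-bound : gameValue G (suc f) staller D ≤ ⌊ suc (Φ D) /2⌋
    staller-bound = staller-value≤ G f D _ v* unfinished legal* λ v lv →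
      ≤-trans (s≤s (proj₂ (value-bounds f (play G D v) (inv-play D v inv))))
              (⌊n/2⌋-mono (s≤s (move-lowers D v inv lv)))
    dominator-bound : gameValue G (suc f) dominator D ≤ ⌊ Φ D /2⌋
    dominator-bound = ≤-trans (dominator-value≤ G f D v* unfinished legal*)
      (≤-trans (s≤s (proj₁ (value-bounds f (play G D v*) (inv-play D v* inv)))) (good-drop-halves drop*))


-- A pattern records, position by position, whether a vertex is dominated.
Pattern : Set
Pattern = ℕ → Bool

-- Cost of a position given its predecessor: an undominated position costs 1,
-- and 1 more if it starts a run of undominated positions.
cost : Bool → Bool → ℕ
cost _     true  = 0
cost true  false = 2
cost false false = 1

before : Pattern → ℕ → Bool
before g zero    = true
before g (suc j) = g j

costAt : Pattern → ℕ → ℕ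
costAt g j = cost (before g j) (g j)

costAt-dominated : ∀ g j → g j ≡ true → costAt g j ≡ 0
costAt-dominated g j gj = cong (cost (before g j)) gj

sumRange : (ℕ → ℕ) → ℕ → ℕ → ℕ
sumRange f a zero    = 0
sumRange f a (suc m) = f a + sumRange f (suc a) m

potential : ℕ → Pattern → ℕ
potential M g = sumRange (costAt g) 0 M

OnRange : (ℕ → Set) → ℕ → ℕ → Set
OnRange P a m = ∀ j → a ≤ j → j < a + m → P j

range-head : ∀ {P a m} → OnRange P a (suc m) → P a
range-head {a = a} {m} on = on a ≤-refl (subst (a <_) (sym (+-suc a m)) (s≤s (m≤m+n a m)))

range-tail : ∀ {P a m} → OnRange P a (suc m) → OnRange P (suc a) m
range-tail {a = a} {m} on j p q = on j (≤-trans (n≤1+n a) p) (subst (j <_) (sym (+-suc a m)) q)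

sum-split : ∀ f a m r → sumRange f a (m + r) ≡ sumRange f a m + sumRange f (a + m) r
sum-split f a zero    r = cong (λ c → sumRange f c r) (sym (+-identityʳ a))
sum-split f a (suc m) r = begin
    f a + sumRange f (suc a) (m + r)
  ≡⟨ cong (f a +_) (sum-split f (suc a) m r) ⟩
    f a + (sumRange f (suc a) m + sumRange f (suc a + m) r)
  ≡⟨ sym (+-assoc (f a) _ _) ⟩
    f a + sumRange f (suc a) m + sumRange f (suc (a + m)) r
  ≡⟨ cong (λ c → f a + sumRange f (suc a) m + sumRange f c r) (sym (+-suc a m)) ⟩
    f a + sumRange f (suc a) m + sumRange f (a + suc m) r ∎
  where open ≡-Reasoning

sum-cong : ∀ {f f'} a m → OnRange (λ j → f j ≡ f' j) a m → sumRange f a m ≡ sumRange f' a m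
sum-cong a zero    eq = refl
sum-cong a (suc m) eq = cong₂ _+_ (range-head eq) (sum-cong (suc a) m (range-tail eq))

sum-const : ∀ {f} c a m → OnRange (λ j → f j ≡ c) a m → sumRange f a m ≡ m * c
sum-const c a zero    eq = refl
sum-const c a (suc m) eq = cong₂ _+_ (range-head eq) (sum-const c (suc a) m (range-tail eq))

sum-even : ∀ {f} a m → OnRange (λ j → f j ≡ 0 ⊎ f j ≡ 2) a m → IsEven (sumRange f a m)
sum-even a zero    _    = 0 , refl
sum-even a (suc m) each with range-head each | sum-even (suc a) m (range-tail each)
... | inj₁ fa≡0 | h , eq = h , cong₂ _+_ fa≡0 eq
... | inj₂ fa≡2 | h , eq = suc h , trans (cong₂ _+_ fa≡2 eq) (cong suc (sym (+-suc h h)))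

-- Windows.  A move fills the window of b: it makes positions b+1, b+2, b+3
-- dominated and leaves all other positions alone.  This changes only the
-- costs of the four positions b+1, …, b+4.
record Filled (b : ℕ) (g g' : Pattern) : Set where
  field
    inside : ∀ j → suc b ≤ j → j ≤ 3 + b → g' j ≡ true
    left   : ∀ j → j ≤ b → g' j ≡ g j
    right  : ∀ j → 4 + b ≤ j → g' j ≡ g j

cost4 : Bool → Bool → Bool → Bool → Bool → ℕ
cost4 b₀ b₁ b₂ b₃ b₄ = cost b₀ b₁ + (cost b₁ b₂ + (cost b₂ b₃ + cost b₃ b₄))

windowCost : Pattern → ℕ → ℕ
windowCost g b = cost4 (g b) (g (1 + b)) (g (2 + b)) (g (3 + b)) (g (4 + b))

-- Filling the window of b lowers its cost to cost true (g (4 + b)), which is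
-- a drop of at least d.
WindowGain : ℕ → Pattern → ℕ → Set
WindowGain d g b = d + cost true (g (4 + b)) ≤ windowCost g b

cost4-filled : ∀ {b₀ b₁ b₂ b₃ b₄ c₄} → b₁ ≡ true → b₂ ≡ true → b₃ ≡ true → b₄ ≡ c₄ →
               cost4 b₀ b₁ b₂ b₃ b₄ ≡ cost true c₄
cost4-filled refl refl refl refl = refl

sum-window : ∀ f b R → sumRange f 0 (suc b + (4 + R)) ≡
  sumRange f 0 (suc b) + ((f (1 + b) + (f (2 + b) + (f (3 + b) + f (4 + b)))) + sumRange f (5 + b) R)
sum-window f b R = trans (sum-split f 0 (suc b) (4 + R))
  (cong (sumRange f 0 (suc b) +_) (regroup (f (1 + b)) (f (2 + b)) (f (3 + b)) (f (4 + b)) (sumRange f (5 + b) R)))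
  where
  regroup : ∀ x₁ x₂ x₃ x₄ c → x₁ + (x₂ + (x₃ + (x₄ + c))) ≡ (x₁ + (x₂ + (x₃ + x₄))) + c
  regroup = solve-∀

window-drop : ∀ M b d {g g'} → 5 + b ≤ M → Filled b g g' → WindowGain d g b → d + potential M g' ≤ potential M g
window-drop M b d {g} {g'} fits filled gain =
  subst (λ L → d + potential L g' ≤ potential L g) length≡ (begin
    d + potential (suc b + (4 + R)) g'
  ≡⟨ cong (d +_) (sum-window (costAt g') b R) ⟩
    d + (sumRange (costAt g') 0 (suc b) + (windowCost g' b + sumRange (costAt g') (5 + b) R))
  ≡⟨ cong₂ (λ A' C' → d + (A' + (windowCost g' b + C'))) prefix suffix ⟩
    d + (A + (windowCost g' b + C))
  ≡⟨ cong (λ w → d + (A + (w + C))) filled-cost ⟩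
    d + (A + (cost true (g (4 + b)) + C))
  ≡⟨ regroup d A _ C ⟩
    A + ((d + cost true (g (4 + b))) + C)
  ≤⟨ +-monoʳ-≤ A (+-monoˡ-≤ C gain) ⟩
    A + (windowCost g b + C)
  ≡⟨ sym (sum-window (costAt g) b R) ⟩
    potential (suc b + (4 + R)) g ∎)
  where
  open ≤-Reasoning
  open Filled filled
  R = M ∸ (5 + b)
  A = sumRange (costAt g) 0 (suc b)
  C = sumRange (costAt g) (5 + b) R
  shuffle : ∀ b R → suc b + (4 + R) ≡ 5 + b + R
  shuffle = solve-∀
  length≡ : suc b + (4 + R) ≡ M
  length≡ = trans (shuffle b R) (m+[n∸m]≡n fits)
  prefix : sumRange (costAt g') 0 (suc b) ≡ A
  prefix = sum-cong 0 (suc b) λ j _ j≤b → cong₂ cost (before-left j (≤-pred j≤b)) (left j (≤-pred j≤b))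
    where
    before-left : ∀ j → j ≤ b → before g' j ≡ before g j
    before-left zero    _   = refl
    before-left (suc j) j<b = left j (≤-trans (n≤1+n j) j<b)
  suffix : sumRange (costAt g') (5 + b) R ≡ C
  suffix = sum-cong (5 + b) R λ { (suc j) (s≤s 4+b≤j) _ →
    cong₂ cost (right j 4+b≤j) (right (suc j) (≤-trans 4+b≤j (n≤1+n j))) }
  filled-cost : windowCost g' b ≡ cost true (g (4 + b))
  filled-cost = cost4-filled (inside (1 + b) ≤-refl (m≤n+m _ 2)) (inside (2 + b) (n≤1+n _) (m≤n+m _ 1))
                             (inside (3 + b) (m≤n+m _ 2) ≤-refl) (right (4 + b) ≤-refl)
  regroup : ∀ d A w C → d + (A + (w + C)) ≡ A + ((d + w) + C)
  regroup = solve-∀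

cost-false-pos : ∀ c → 1 ≤ cost c false
cost-false-pos true  = s≤s z≤n
cost-false-pos false = s≤s z≤n

cost-shortcut : ∀ c x y → cost true y ≤ cost c x + cost x y
cost-shortcut c     true  y     = ≤-refl
cost-shortcut c     false true  = z≤n
cost-shortcut true  false false = s≤s (s≤s z≤n)
cost-shortcut false false false = ≤-refl

gain1 : ∀ {b₀ b₁ b₂ b₃ b₄} → b₁ ≡ false ⊎ b₂ ≡ false ⊎ b₃ ≡ false → 1 + cost true b₄ ≤ cost4 b₀ b₁ b₂ b₃ b₄
gain1 {b₀} {false} {b₂} {b₃} {b₄} _ =
  +-mono-≤ (cost-false-pos b₀) (≤-trans (cost-shortcut b₂ b₃ b₄) (m≤n+m _ (cost false b₂)))
gain1 {b₁ = true} {false} {b₃} {b₄} _ = s≤s (m≤n⇒m≤1+n (cost-shortcut false b₃ b₄))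
gain1 {b₁ = true} {true} {false} {b₄} _ = s≤s (cost-shortcut false false b₄)
gain1 {b₁ = true} {true} {true} (inj₁ ())
gain1 {b₁ = true} {true} {true} (inj₂ (inj₁ ()))
gain1 {b₁ = true} {true} {true} (inj₂ (inj₂ ()))

gain3 : ∀ {b₀ b₁ b₂} b₃ b₄ → b₀ ≡ true → b₁ ≡ false → b₂ ≡ false → 3 + cost true b₄ ≤ cost4 b₀ b₁ b₂ b₃ b₄
gain3 b₃ b₄ refl refl refl = s≤s (s≤s (s≤s (cost-shortcut false b₃ b₄)))

gain2 : ∀ b₀ {b₁ b₂ b₃} b₄ → b₁ ≡ true → b₂ ≡ false → b₃ ≡ true → 2 + cost true b₄ ≤ cost4 b₀ b₁ b₂ b₃ b₄
gain2 b₀ b₄ refl refl refl = ≤-refl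

window-position : ∀ {b p} → suc b ≤ p → p ≤ 3 + b → p ≡ 1 + b ⊎ p ≡ 2 + b ⊎ p ≡ 3 + b
window-position b<p p≤3+b with m≤n⇒m<n∨m≡n p≤3+b
... | inj₂ p≡3+b = inj₂ (inj₂ p≡3+b)
... | inj₁ p<3+b with m≤n⇒m<n∨m≡n (≤-pred p<3+b)
...   | inj₂ p≡2+b = inj₂ (inj₁ p≡2+b)
...   | inj₁ p<2+b = inj₁ (≤-antisym (≤-pred p<2+b) b<p)

-- A fill that newly dominates some position p gains at least 1, since p must
-- lie inside the window.
filled-gain1 : ∀ {b g g' p} → Filled b g g' → g p ≡ false → g' p ≡ true → WindowGain 1 g b
filled-gain1 {b} {g} {g'} {p} filled gp g'p with p ≤? b | 4 + b ≤? p
... | yes p≤b | _        = clash g'p (trans (Filled.left filled p p≤b) gp)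
... | no _    | yes far  = clash g'p (trans (Filled.right filled p far) gp)
... | no b≮p  | no p≮far = gain1 (map-⊎ at (map-⊎ at at) (window-position (≰⇒> b≮p) (≤-pred (≰⇒> p≮far))))
  where
  at : ∀ {q} → p ≡ q → g q ≡ false
  at refl = gp

NoAdjacentUndominated : ℕ → Pattern → Set
NoAdjacentUndominated M g = ∀ j → j < M → g j ≡ false → g (suc j) ≡ true

no-adjacent-extend : ∀ {M g} → NoAdjacentUndominated M g → (g M ≡ false → g (suc M) ≡ true) →
                     NoAdjacentUndominated (suc M) g
no-adjacent-extend none last j j<1+M gj with m≤n⇒m<n∨m≡n (≤-pred j<1+M)
... | inj₁ j<M  = none j j<M gj
... | inj₂ refl = last gj

adjacent-undominated? : ∀ (g : Pattern) M →
  (Σ ℕ λ j → g j ≡ false × g (suc j) ≡ false) ⊎ NoAdjacentUndominated M g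
adjacent-undominated? g zero = inj₂ λ _ ()
adjacent-undominated? g (suc M) with adjacent-undominated? g M
... | inj₁ pair = inj₁ pair
... | inj₂ none with true-or-false (g M) | true-or-false (g (suc M))
...   | inj₁ gM | _        = inj₂ (no-adjacent-extend none (clash gM))
...   | inj₂ gM | inj₁ gsM = inj₂ (no-adjacent-extend none λ _ → gsM)
...   | inj₂ gM | inj₂ gsM = inj₁ (M , gM , gsM)

run-start : ∀ (g : Pattern) → g 0 ≡ true → ∀ j → g j ≡ false → g (suc j) ≡ false →
            Σ ℕ λ b → g b ≡ true × g (1 + b) ≡ false × g (2 + b) ≡ false
run-start g g0 zero    gj _   = clash g0 gj
run-start g g0 (suc j) gsj gssj with true-or-false (g j)
... | inj₁ gj = j , gj , gsj , gssj
... | inj₂ gj = run-start g g0 j gj gsj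

-- With only isolated undominated positions every cost is 0 or 2.
no-adjacent-even : ∀ M g → NoAdjacentUndominated M g → IsEven (potential M g)
no-adjacent-even M g none = sum-even 0 M λ j _ j<M → cost-0-or-2 j j<M
  where
  cost-0-or-2 : ∀ j → j < M → costAt g j ≡ 0 ⊎ costAt g j ≡ 2
  cost-0-or-2 j j<M with true-or-false (g j)
  ... | inj₁ gj = inj₁ (costAt-dominated g j gj)
  cost-0-or-2 zero    _    | inj₂ gj = inj₂ (cong (cost true) gj)
  cost-0-or-2 (suc j) sj<M | inj₂ gsj with true-or-false (g j)
  ... | inj₁ gj = inj₂ (cong₂ cost gj gsj)
  ... | inj₂ gj = clash (none j (<-trans (n<1+n j) sj<M) gj) gsj

dominator-window : ∀ M g a → g 0 ≡ true → 2 + a < M → g (2 + a) ≡ false →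
  Σ ℕ λ b → g (2 + b) ≡ false × (WindowGain 3 g b ⊎ (WindowGain 2 g b × IsEven (potential M g)))
dominator-window M g a g0 a<M ga with adjacent-undominated? g M
... | inj₁ (j , gj , gsj) with run-start g g0 j gj gsj
...   | b , gb , g1b , g2b = b , g2b , inj₁ (gain3 (g (3 + b)) (g (4 + b)) gb g1b g2b)
dominator-window M g a g0 a<M ga | inj₂ none =
  a , ga , inj₂ (gain2 (g a) (g (4 + a)) g1a ga (none (2 + a) a<M ga) , no-adjacent-even M g none)
  where
  g1a : g (1 + a) ≡ true
  g1a with true-or-false (g (1 + a))
  ... | inj₁ dominated   = dominated
  ... | inj₂ undominated = clash (none (1 + a) (<-trans (n<1+n _) a<M) undominated) ga

potential-single-run : ∀ a r R (g : Pattern) → OnRange (λ j → g j ≡ true) 0 (suc a) →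
  OnRange (λ j → g j ≡ false) (suc a) (suc r) → (∀ j → 2 + a + r ≤ j → g j ≡ true) →
  potential (suc a + (suc r + R)) g ≡ 2 + r
potential-single-run a r R g dominated-before undominated dominated-after = begin
    potential (suc a + (suc r + R)) g
  ≡⟨ sum-split (costAt g) 0 (suc a) (suc r + R) ⟩
    sumRange (costAt g) 0 (suc a) + (costAt g (suc a) + sumRange (costAt g) (2 + a) (r + R))
  ≡⟨ cong₂ (λ P Q → P + (costAt g (suc a) + Q)) before-run (sum-split (costAt g) (2 + a) r R) ⟩
    suc a * 0 + (costAt g (suc a) + (sumRange (costAt g) (2 + a) r + sumRange (costAt g) (2 + a + r) R))
  ≡⟨ cong₂ (λ S Q → suc a * 0 + (S + Q)) run-head (cong₂ _+_ run-rest after-run) ⟩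
    suc a * 0 + (2 + (r * 1 + R * 0))
  ≡⟨ simplify a r R ⟩
    2 + r ∎
  where
  open ≡-Reasoning
  before-run : sumRange (costAt g) 0 (suc a) ≡ suc a * 0
  before-run = sum-const 0 0 (suc a) λ j p q → costAt-dominated g j (dominated-before j p q)
  run-head : costAt g (suc a) ≡ 2
  run-head = cong₂ cost (dominated-before a z≤n ≤-refl) (range-head undominated)
  run-rest : sumRange (costAt g) (2 + a) r ≡ r * 1
  run-rest = sum-const 1 (2 + a) r λ { (suc j) (s≤s a<j) j<end →
    cong₂ cost (undominated j a<j (s≤s (≤-trans (≤-pred (≤-pred j<end)) (+-monoʳ-≤ a (n≤1+n r)))))
               (range-tail undominated (suc j) (s≤s a<j) j<end) }
  after-run : sumRange (costAt g) (2 + a + r) R ≡ R * 0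
  after-run = sum-const 0 (2 + a + r) R λ j p _ → costAt-dominated g j (dominated-after j p)
  simplify : ∀ a r R → suc a * 0 + (2 + (r * 1 + R * 0)) ≡ 2 + r
  simplify = solve-∀

readOr : ∀ {n} → (Fin n → Bool) → ℕ → Bool
readOr {zero}  f j       = true
readOr {suc n} f zero    = f fzero
readOr {suc n} f (suc j) = readOr (λ i → f (fsuc i)) j

readOr-toℕ : ∀ {n} (f : Fin n → Bool) i → readOr f (toℕ i) ≡ f i
readOr-toℕ f fzero    = refl
readOr-toℕ f (fsuc i) = readOr-toℕ (λ i → f (fsuc i)) i

readOr-beyond : ∀ {n} (f : Fin n → Bool) j → n ≤ j → readOr f j ≡ true
readOr-beyond {zero}  f j       _       = refl
readOr-beyond {suc n} f (suc j) (s≤s p) = readOr-beyond (λ i → f (fsuc i)) j p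


module Construction (k m : ℕ) (adjX : Adj k) (W : Fin k → Bool) where

  n : ℕ
  n = 3 + m

  G : Adj (k + n)
  G = constructG n adjX W

  xv : Fin k → Fin (k + n)
  xv x = x ↑ˡ n

  pv : Fin n → Fin (k + n)
  pv i = k ↑ʳ i

  y : Fin (k + n)
  y = pv fzero

  data Vertex : Fin (k + n) → Set where
    inX    : (x : Fin k) → Vertex (xv x)
    onPath : (i : Fin n) → Vertex (pv i)

  vertex : ∀ u → Vertex u
  vertex u with splitAt k u in split
  ... | inj₁ x = subst Vertex (splitAt⁻¹-↑ˡ split) (inX x)
  ... | inj₂ i = subst Vertex (splitAt⁻¹-↑ʳ split) (onPath i)

  adj-path-path : ∀ i i' → G (pv i) (pv i') ≡ pathAdj i i'
  adj-path-path i i' = cong₂ (adjSum adjX W) (splitAt-↑ʳ k n i) (splitAt-↑ʳ k n i')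

  adj-X-path : ∀ x i → G (xv x) (pv i) ≡ crossAdj W x i
  adj-X-path x i = cong₂ (adjSum adjX W) (splitAt-↑ˡ k x n) (splitAt-↑ʳ k n i)

  adj-path-X : ∀ i x → G (pv i) (xv x) ≡ crossAdj W x i
  adj-path-X i x = cong₂ (adjSum adjX W) (splitAt-↑ʳ k n i) (splitAt-↑ˡ k x n)

  nbhd-refl : ∀ u → closedNbhd G u u ≡ true
  nbhd-refl u = ∨-trueˡ (G u u) (⌊⌋-true (u ≟ u) refl)

  nbhd-path-near : ∀ i i' → toℕ i ≤ suc (toℕ i') → toℕ i' ≤ suc (toℕ i) → closedNbhd G (pv i) (pv i') ≡ true
  nbhd-path-near i i' i≤1+i' i'≤1+i with <-cmp (toℕ i') (toℕ i)
  ... | tri≈ _ same _ = ∨-trueˡ _ (⌊⌋-true (pv i' ≟ pv i) (cong pv (toℕ-injective same)))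
  ... | tri< i'<i _ _ = ∨-trueʳ _ (trans (adj-path-path i i')
                          (∨-trueʳ _ (⌊⌋-true (suc (toℕ i') ℕ.≟ toℕ i) (≤-antisym i'<i i≤1+i'))))
  ... | tri> _ _ i<i' = ∨-trueʳ _ (trans (adj-path-path i i')
                          (∨-trueˡ _ (⌊⌋-true (suc (toℕ i) ℕ.≟ toℕ i') (≤-antisym i<i' i'≤1+i))))

  nbhd-path-far : ∀ i i' → 2 + toℕ i' ≤ toℕ i ⊎ 2 + toℕ i ≤ toℕ i' → closedNbhd G (pv i) (pv i') ≡ false
  nbhd-path-far i i' apart = trans (cong (pv i' == pv i ∨_) (adj-path-path i i'))
    (cong₂ _∨_ (⌊⌋-false (pv i' ≟ pv i) (distinct ∘ cong toℕ ∘ ↑ʳ-injective k i' i))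
               (cong₂ _∨_ (⌊⌋-false (_ ℕ.≟ _) (not-next apart)) (⌊⌋-false (_ ℕ.≟ _) (not-next (swap apart)))))
    where
    distinct : toℕ i' ≢ toℕ i
    distinct = [ (λ p → <⇒≢ (≤-trans (n≤1+n _) p)) , (λ p → >⇒≢ (≤-trans (n≤1+n _) p)) ] apart
    not-next : ∀ {a b} → 2 + b ≤ a ⊎ 2 + a ≤ b → suc a ≢ b
    not-next (inj₁ p) = >⇒≢ (m<n⇒m<1+n (≤-trans (n≤1+n _) p))
    not-next (inj₂ p) = <⇒≢ p

  nbhd-X-path : ∀ x i → closedNbhd G (xv x) (pv i) ≡ crossAdj W x i
  nbhd-X-path x i = trans (cong (_∨ G (xv x) (pv i)) (⌊⌋-false (pv i ≟ xv x) different-sides)) (adj-X-path x i)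
    where
    different-sides : pv i ≢ xv x
    different-sides same = <⇒≱ (toℕ<n x) (begin
      k               ≤⟨ m≤m+n k (toℕ i) ⟩
      k + toℕ i       ≡⟨ sym (toℕ-↑ʳ k i) ⟩
      toℕ (pv i)      ≡⟨ cong toℕ same ⟩
      toℕ (xv x)      ≡⟨ toℕ-↑ˡ x n ⟩
      toℕ x           ∎)
      where open ≤-Reasoning

  play-hit : ∀ D v u → closedNbhd G v u ≡ true → play G D v u ≡ true
  play-hit D v u hit = ∨-trueʳ (D u) hit

  play-miss : ∀ D v u → closedNbhd G v u ≡ false → play G D v u ≡ D u
  play-miss D v u miss = trans (cong (D u ∨_) miss) (∨-identityʳ (D u))

  play-keeps : ∀ D v u → D u ≡ true → play G D v u ≡ true
  play-keeps D v u du = ∨-trueˡ _ du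

  -- The path read as a pattern: positions 0 and 1 are dominated sentinels,
  -- position 2 + i is path vertex i, and positions beyond the path count as
  -- dominated.  Path vertex i then sits at the centre of the window of i.
  pathPattern : DomSet (k + n) → Pattern
  pathPattern D zero          = true
  pathPattern D (suc zero)    = true
  pathPattern D (suc (suc j)) = readOr (λ i → D (pv i)) j

  pattern-at : ∀ D i → pathPattern D (2 + toℕ i) ≡ D (pv i)
  pattern-at D i = readOr-toℕ (λ i → D (pv i)) i

  pattern-beyond : ∀ D j → n ≤ j → pathPattern D (2 + j) ≡ true
  pattern-beyond D j = readOr-beyond (λ i → D (pv i)) j

  data Position : ℕ → Set where
    sentinel₀ : Position 0
    sentinel₁ : Position 1
    at        : (i : Fin n) → Position (2 + toℕ i)
    beyond    : ∀ j → n ≤ j → Position (2 + j)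

  position : ∀ p → Position p
  position zero          = sentinel₀
  position (suc zero)    = sentinel₁
  position (suc (suc j)) with j <? n
  ... | yes j<n = subst (λ q → Position (2 + q)) (toℕ-fromℕ< j<n) (at (fromℕ< j<n))
  ... | no  j≮n = beyond j (≮⇒≥ j≮n)

  pattern-true : ∀ D (S : ℕ → Set) → (∀ i → S (2 + toℕ i) → D (pv i) ≡ true) →
                 ∀ p → S p → pathPattern D p ≡ true
  pattern-true D S hits p s with position p
  ... | sentinel₀    = refl
  ... | sentinel₁    = refl
  ... | at i         = trans (pattern-at D i) (hits i s)
  ... | beyond j far = pattern-beyond D j far

  pattern-same : ∀ D D' (S : ℕ → Set) → (∀ i → S (2 + toℕ i) → D' (pv i) ≡ D (pv i)) →
                 ∀ p → S p → pathPattern D' p ≡ pathPattern D p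
  pattern-same D D' S same p s with position p
  ... | sentinel₀    = refl
  ... | sentinel₁    = refl
  ... | at i         = trans (pattern-at D' i) (trans (same i s) (sym (pattern-at D i)))
  ... | beyond j far = trans (pattern-beyond D' j far) (sym (pattern-beyond D j far))

  pattern-false : ∀ D (S : ℕ → Set) → (∀ i → S (2 + toℕ i) → D (pv i) ≡ false) →
                  ∀ j → j < n → S (2 + j) → pathPattern D (2 + j) ≡ false
  pattern-false D S misses j j<n s with position (2 + j)
  ... | at i         = trans (pattern-at D i) (misses i s)
  ... | beyond j far = ⊥-elim (<⇒≱ j<n far)

  -- After Dominator's opening move on y, all of X and y stay dominated.
  record Invariant (D : DomSet (k + n)) : Set where
    field
      X-dominated : ∀ x → D (xv x) ≡ true
      y-dominated : D y ≡ true

  invariant-play : ∀ D v → Invariant D → Invariant (play G D v)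
  invariant-play D v inv = record
    { X-dominated = λ x → play-keeps D v (xv x) (X-dominated x)
    ; y-dominated = play-keeps D v y y-dominated
    }
    where open Invariant inv

  -- The potential of a position: the path pattern on positions 0, …, n + 4,
  -- which contain the whole path and every window of a move.
  Φ : DomSet (k + n) → ℕ
  Φ D = potential (n + 5) (pathPattern D)

  window-fits : ∀ {b} → b ≤ n → 5 + b ≤ n + 5
  window-fits b≤n = ≤-trans (+-monoʳ-≤ 5 b≤n) (≤-reflexive (+-comm 5 n))

  path-move-fills : ∀ D i → Filled (toℕ i) (pathPattern D) (pathPattern (play G D (pv i)))
  path-move-fills D i = record
    { inside = λ j p q → pattern-true D' (λ j → suc c ≤ j × j ≤ 3 + c)
        (λ i' (p , q) → play-hit D (pv i) (pv i') (nbhd-path-near i i' (≤-pred p) (≤-pred (≤-pred q)))) j (p , q)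
    ; left   = pattern-same D D' (_≤ c) λ i' p → play-miss D (pv i) (pv i') (nbhd-path-far i i' (inj₁ p))
    ; right  = pattern-same D D' (4 + c ≤_) λ i' p →
        play-miss D (pv i) (pv i') (nbhd-path-far i i' (inj₂ (≤-pred (≤-pred p))))
    }
    where
    c = toℕ i
    D' = play G D (pv i)

  y-index : ∀ D i → Invariant D → D (pv i) ≡ false → isY i ≡ false
  y-index D i inv undominated = ⌊⌋-false (toℕ i ℕ.≟ 0) λ i≡0 →
    clash (subst (λ j → D (pv j) ≡ true) (sym (toℕ-injective {i = i} {j = fzero} i≡0)) y-dominated) undominated
    where open Invariant inv

  -- A vertex of X changes the status of a path vertex only if that vertex is
  -- y' and the X-vertex lies in W (y is already dominated).
  X-move-on-path : ∀ D x i → Invariant D → (isY' i ∧ W x) ≡ false → play G D (xv x) (pv i) ≡ D (pv i)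
  X-move-on-path D x i inv not-y' with true-or-false (D (pv i))
  ... | inj₁ dominated   = trans (play-keeps D (xv x) (pv i) dominated) (sym dominated)
  ... | inj₂ undominated = play-miss D (xv x) (pv i)
          (trans (nbhd-X-path x i) (cong₂ _∨_ (y-index D i inv undominated) not-y'))

  -- A vertex of W fills the window of n, which contains y' (position n + 1).
  W-move-fills : ∀ D x → Invariant D → W x ≡ true → Filled n (pathPattern D) (pathPattern (play G D (xv x)))
  W-move-fills D x inv wx = record
    { inside = λ j p q → pattern-true D' (suc n ≤_) (λ i p → play-hit D (xv x) (pv i)
        (trans (nbhd-X-path x i) (∨-trueʳ (isY i) (trans (cong (_∧ W x) (⌊⌋-true (_ ℕ.≟ _) (is-y' i p))) wx)))) j p
    ; left   = pattern-same D D' (_≤ n) λ i p →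
        X-move-on-path D x i inv (cong (_∧ W x) (⌊⌋-false (_ ℕ.≟ _) (<⇒≢ (≤-pred p))))
    ; right  = pattern-same D D' (4 + n ≤_) λ i p →
        ⊥-elim (<⇒≱ (toℕ<n i) (m+n≤o⇒n≤o 2 (≤-pred (≤-pred p))))
    }
    where
    D' = play G D (xv x)
    is-y' : ∀ i → suc n ≤ 2 + toℕ i → toℕ i ≡ 2 + m
    is-y' i p = ≤-antisym (≤-pred (toℕ<n i)) (≤-pred (≤-pred p))

  non-W-move-idle : ∀ D x → Invariant D → W x ≡ false → ∀ p → pathPattern (play G D (xv x)) p ≡ pathPattern D p
  non-W-move-idle D x inv wx p = pattern-same D (play G D (xv x)) (λ _ → ⊤)
    (λ i _ → X-move-on-path D x i inv (trans (cong (isY' i ∧_) wx) (∧-zeroʳ (isY' i)))) p tt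

  MoveEffect : DomSet (k + n) → Fin (k + n) → Set
  MoveEffect D v = (Σ ℕ λ b → b ≤ n × Filled b (pathPattern D) (pathPattern (play G D v)))
                 ⊎ (∀ p → pathPattern (play G D v) p ≡ pathPattern D p)

  move-effect : ∀ D v → Invariant D → MoveEffect D v
  move-effect D v inv with vertex v
  ... | onPath i = inj₁ (toℕ i , <⇒≤ (toℕ<n i) , path-move-fills D i)
  ... | inX x with true-or-false (W x)
  ...   | inj₁ wx = inj₁ (n , ≤-refl , W-move-fills D x inv wx)
  ...   | inj₂ wx = inj₂ (non-W-move-idle D x inv wx)

  legal-newly-dominates : ∀ D v → Invariant D → legal G D v ≡ true →
                          Σ (Fin n) λ i → D (pv i) ≡ false × play G D v (pv i) ≡ true
  legal-newly-dominates D v inv lv with satisfying-entry _ (allFin (k + n)) lv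
  ... | u , newly with ∧-not {closedNbhd G v u} {D u} newly | vertex u
  ...   | _   , undominated | inX x    = clash (Invariant.X-dominated inv x) undominated
  ...   | hit , undominated | onPath i = i , undominated , play-hit D v (pv i) hit

  legal-if-undominated : ∀ D v → D v ≡ false → legal G D v ≡ true
  legal-if-undominated D v dv = any-holds _ (∈-allFin v) (cong₂ _∧_ (nbhd-refl v) (cong not dv))

  move-lowers : ∀ D v → Invariant D → legal G D v ≡ true → suc (Φ (play G D v)) ≤ Φ D
  move-lowers D v inv lv with legal-newly-dominates D v inv lv | move-effect D v inv
  ... | i , was , now | inj₁ (b , b≤n , filled) = window-drop (n + 5) b 1 (window-fits b≤n) filled
          (filled-gain1 {p = 2 + toℕ i} filled (trans (pattern-at D i) was) (trans (pattern-at (play G D v) i) now))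
  ... | i , was , now | inj₂ idle =
          clash (trans (sym (idle (2 + toℕ i))) (trans (pattern-at (play G D v) i) now)) (trans (pattern-at D i) was)

  undominated-path-vertex : ∀ D b → pathPattern D (2 + b) ≡ false → Σ (Fin n) λ i → toℕ i ≡ b × D (pv i) ≡ false
  undominated-path-vertex D b undominated with position (2 + b)
  ... | at i         = i , refl , trans (sym (pattern-at D i)) undominated
  ... | beyond b far = clash (pattern-beyond D b far) undominated

  path-position-fits : ∀ i → 2 + toℕ i < n + 5
  path-position-fits i = ≤-trans (+-monoʳ-≤ 2 (toℕ<n i)) (≤-trans (≤-reflexive (+-comm 2 n)) (+-monoʳ-≤ n (m≤n+m 2 3)))

  good-move : ∀ D → Invariant D → allDominated D ≡ false →
              Σ (Fin (k + n)) λ v → legal G D v ≡ true × GoodDrop (Φ (play G D v)) (Φ D)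
  good-move D inv unfinished with failing-entry D (allFin (k + n)) unfinished
  ... | u , du with vertex u
  ...   | inX x = clash (Invariant.X-dominated inv x) du
  ...   | onPath i with dominator-window (n + 5) (pathPattern D) (toℕ i) refl (path-position-fits i) (trans (pattern-at D i) du)
  ...     | b , gb , gain with undominated-path-vertex D b gb
  ...       | i' , refl , di' = pv i' , legal-if-undominated D (pv i') di' , realise gain
    where
    fill : ∀ {d} → WindowGain d (pathPattern D) (toℕ i') → d + Φ (play G D (pv i')) ≤ Φ D
    fill {d} = window-drop (n + 5) (toℕ i') d (window-fits (<⇒≤ (toℕ<n i'))) (path-move-fills D i')
    realise : WindowGain 3 (pathPattern D) (toℕ i') ⊎ (WindowGain 2 (pathPattern D) (toℕ i') × IsEven (Φ D)) →
              GoodDrop (Φ (play G D (pv i'))) (Φ D)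
    realise (inj₁ gain3)          = inj₁ (fill gain3)
    realise (inj₂ (gain2 , even)) = inj₂ (fill gain2 , even)

  ∅ : DomSet (k + n)
  ∅ _ = false

  D₀ : DomSet (k + n)
  D₀ = play G ∅ y

  invariant-D₀ : Invariant D₀
  invariant-D₀ = record
    { X-dominated = λ x → play-hit ∅ y (xv x) (∨-trueʳ (xv x == y) (adj-path-X fzero x))
    ; y-dominated = play-hit ∅ y y (nbhd-refl y)
    }

  -- After the opening, path vertices 2, …, n − 1 form one undominated run.
  potential-D₀ : Φ D₀ ≡ 2 + m
  potential-D₀ = trans (cong (λ M → potential M (pathPattern D₀)) (length m))
                       (potential-single-run 3 m 3 (pathPattern D₀) before-run run after-run)
    where
    length : ∀ m → 3 + m + 5 ≡ 4 + (suc m + 3)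
    length = solve-∀
    before-run : OnRange (λ j → pathPattern D₀ j ≡ true) 0 4
    before-run j _ = pattern-true D₀ (_< 4)
      (λ i p → play-hit ∅ y (pv i) (nbhd-path-near fzero i z≤n (≤-pred (≤-pred (≤-pred p))))) j
    run : OnRange (λ j → pathPattern D₀ j ≡ false) 4 (suc m)
    run (suc zero) (s≤s ()) _
    run (suc (suc j)) 4≤p p<end = pattern-false D₀ (4 ≤_)
      (λ i p → play-miss ∅ y (pv i) (nbhd-path-far fzero i (inj₂ (≤-pred (≤-pred p))))) j
      (≤-pred (≤-pred p<end)) 4≤p
    after-run : ∀ j → 5 + m ≤ j → pathPattern D₀ j ≡ true
    after-run = pattern-true D₀ (5 + m ≤_) λ i far → ⊥-elim (<⇒≱ (toℕ<n i) (≤-pred (≤-pred far)))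

  open PotentialArgument G Invariant Φ invariant-play move-lowers good-move

  game-bound : γg G ≤ ⌊ 5 + m /2⌋
  game-bound = begin
    gameValue G (k + n) dominator ∅
      ≡⟨ cong (λ f → gameValue G f dominator ∅) (+-suc k (2 + m)) ⟩
    gameValue G (suc (k + (2 + m))) dominator ∅
      ≤⟨ dominator-value≤ G (k + (2 + m)) ∅ y (all-fails ∅ (∈-allFin y) refl) (legal-if-undominated ∅ y refl) ⟩
    suc (gameValue G (k + (2 + m)) staller D₀)
      ≤⟨ s≤s (proj₁ (value-bounds (k + (2 + m)) D₀ invariant-D₀)) ⟩
    suc ⌊ suc (Φ D₀) /2⌋
      ≡⟨ cong (λ φ → suc ⌊ suc φ /2⌋) potential-D₀ ⟩
    ⌊ 5 + m /2⌋ ∎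
    where open ≤-Reasoning


-- The Hamiltonian path supplies a vertex w of X, so n(G) = n(X) + n ≥ n + 1
-- and ⌊(5 + m)/2⌋ = 1 + ⌊n/2⌋ ≤ ⌈n(G)/2⌉.
proposition5p2 : (k : ℕ) (adjX : Adj k) → IsSimpleGraph adjX → Traceable adjX →
    (n : ℕ) → n ≥ 3 → (W : Fin k → Bool) →
    Σ (List (Fin k)) (λ ps → IsHamiltonianPath adjX ps ×
    Σ (Fin k) (λ w → (W w ≡ true) × IsEndVertex ps w)) →
    γg (constructG n adjX W) ≤ ⌈ (k + n) /2⌉
proposition5p2 k adjX _ _ _ (s≤s (s≤s (s≤s (z≤n {n = m})))) W (_ , _ , w , _) =
  ≤-trans (Construction.game-bound k m adjX W) (⌊n/2⌋-mono (s≤s (+-monoˡ-≤ (3 + m) X-nonempty)))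
  where
  X-nonempty : 1 ≤ k
  X-nonempty = ≤-trans (s≤s z≤n) (toℕ<n w)
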